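{- Let $\Lambda=\{\lambda_0=0<\lambda_1<\lambda_2<\dots\}$ be a numerical semigroup different from $\mathbb N$, with conductor $c$ and rank $k\ge 1$, and let $L(\Lambda)=\{\lambda_0,\dots,\lambda_{k-1}\}$ be its set of left elements. Let $\lambda$ be an integer with $c\le\lambda<2c$, and let $j\in\{0,\dots,k-1\}$ be such that $\lambda_j\le\lambda-c<\lambda_{j+1}$. Then: (a) $\lambda-\lambda_j$ is an order-$j$ seed of $\Lambda$ if and only if $\lambda$ is not the sum of two (not necessarily distinct) elements of $L(\Lambda)$; (b) $\lambda-\lambda_j$ is an order-$j$ seed of $\Lambda$ if and only if $\lambda$ is not the sum of two (not necessarily distinct) elements of $\{\lambda_{j+1},\dots,\lambda_{k-1}\}$.
   Context: A numerical semigroup is a cofinite submonoid of $\mathbb N$; its elements are listed increasingly as $\lambda_0=0<\lambda_1<\dots$. Gaps are the elements of $\mathbb N\setminus\Lambda$; the genus $g$ is the number of gaps; the conductor $c$ is the largest gap plus one; the rank is $k=c-g$, so that $\lambda_k=c$ and the left elements (elements of $\Lambda$ smaller than $c$) are exactly $\lambda_0,\dots,\lambda_{k-1}$. For $p<k$, an element $\lambda_s\ge c$ of $\Lambda$ is an order-$p$ seed of $\Lambda$ if $\lambda_s+\lambda_p\ne\lambda_i+\lambda_j$ for all indices $i,j$ with $p<i\le j<s$. -}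

module Defs where

open import Data.Nat using (ℕ; zero; suc; _+_; _∸_; _≤_; _<_)
open import Data.Product using (Σ; ∃; _×_; _,_)
open import Relation.Nullary using (¬_; yes; no)
open import Relation.Unary using (Pred; Decidable)
open import Relation.Binary.PropositionalEquality using (_≡_; _≢_)
open import Level using (0ℓ)

record NumericalSemigroup : Set₁ where
  field
    member   : Pred ℕ 0ℓ
    member?  : Decidable member
    zero∈    : member 0
    +-closed : ∀ {a b} → member a → member b → member (a + b)
    cofinite : ∃ λ N → ∀ n → N ≤ n → member n
open NumericalSemigroup public

IsEnumeration : NumericalSemigroup → (ℕ → ℕ) → Set
IsEnumeration Λ lam =
  (∀ i → lam i < lam (suc i)) ×
  (∀ n → (member Λ n → ∃ λ i → lam i ≡ n) × (∃ (λ i → lam i ≡ n) → member Λ n))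

IsConductor : NumericalSemigroup → ℕ → Set
IsConductor Λ c =
  (∃ λ m → suc m ≡ c × ¬ member Λ m) × (∀ n → ¬ member Λ n → n ≤ m′)
  where m′ = c ∸ 1

gapsBelow : NumericalSemigroup → ℕ → ℕ
gapsBelow Λ zero = 0
gapsBelow Λ (suc n) with member? Λ n
... | yes _ = gapsBelow Λ n
... | no  _ = suc (gapsBelow Λ n)

-- genus (number of gaps; all gaps lie below the conductor c) and rank k = c - g
genus : NumericalSemigroup → ℕ → ℕ
genus Λ c = gapsBelow Λ c

rank : NumericalSemigroup → ℕ → ℕ
rank Λ c = c ∸ genus Λ c

IsSeed : (ℕ → ℕ) → ℕ → ℕ → ℕ → Set
IsSeed lam c p x =
  Σ ℕ λ s → lam s ≡ x × c ≤ x ×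
    (∀ i j → p < i → i ≤ j → j < s → x + lam p ≢ lam i + lam j)

{-# OPTIONS --safe #-}
module Submission where

-- With x = l ∸ λ_j we have x ≥ c, so x = λ_s ∈ Λ, and x + λ_j = l.  For a decomposition
-- l = λ_a + λ_b the window λ_j ≤ l ∸ c < λ_{j+1} makes λ_b < c equivalent to l ∸ c < λ_a,
-- that is, to j < a.  Hence the relations x + λ_j = λ_a + λ_b with j < a ≤ b < s that an
-- order-j seed forbids are exactly the decompositions of l into two left elements, and
-- both summands of such a decomposition automatically have index above j.

open import Defs
open import Data.Nat using (ℕ; zero; suc; _+_; _*_; _∸_; _≤_; _<_; s≤s; s≤s⁻¹; _≤′_; ≤′-refl; ≤′-step)
open import Data.Nat.Properties
open import Data.Product using (∃; _×_; _,_; proj₁; proj₂)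
open import Data.Sum using (inj₁; inj₂)
open import Function using (_∘_)
open import Function.Bundles using (_⇔_; mk⇔; module Equivalence)
open import Function.Construct.Composition using (_⇔-∘_)
open import Relation.Nullary using (¬_; yes; no; contradiction)
open import Relation.Binary.PropositionalEquality
  using (_≡_; _≢_; refl; sym; trans; cong; subst; subst₂; module ≡-Reasoning)
open Equivalence using (to; from)

n≤m∸o⇒o≤m∸n : ∀ {m n o} → o ≤ m → n ≤ m ∸ o → o ≤ m ∸ n
n≤m∸o⇒o≤m∸n {m} {n} o≤m n≤m∸o = subst (_≤ m ∸ n) (m∸[m∸n]≡n o≤m) (∸-monoʳ-≤ m n≤m∸o)

n<o⇔m+n∸o<m : ∀ {m n o} → o ≤ m + n → (n < o ⇔ m + n ∸ o < m)
n<o⇔m+n∸o<m {m} {n} {o} o≤m+n = mk⇔ to′ from′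
  where
  to′ : n < o → m + n ∸ o < m
  to′ n<o = ≰⇒> λ m≤m+n∸o → <⇒≱ (+-monoʳ-< m n<o) (subst (m + o ≤_) (m∸n+n≡m o≤m+n) (+-monoˡ-≤ o m≤m+n∸o))
  from′ : m + n ∸ o < m → n < o
  from′ m+n∸o<m = ≰⇒> λ o≤n → <⇒≱ m+n∸o<m (subst (m ≤_) (sym (+-∸-assoc m o≤n)) (m≤m+n m (n ∸ o)))

module StrictlyIncreasing {f : ℕ → ℕ} (f-step : ∀ i → f i < f (suc i)) where

  mono-≤′ : ∀ {i j} → i ≤′ j → f i ≤ f j
  mono-≤′ ≤′-refl        = ≤-refl
  mono-≤′ (≤′-step i≤′j) = ≤-trans (mono-≤′ i≤′j) (<⇒≤ (f-step _))

  mono-≤ : ∀ {i j} → i ≤ j → f i ≤ f j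
  mono-≤ i≤j = mono-≤′ (≤⇒≤′ i≤j)

  mono-< : ∀ {i j} → i < j → f i < f j
  mono-< {i} i<j = <-≤-trans (f-step i) (mono-≤ i<j)

  cancel-≤ : ∀ {i j} → f i ≤ f j → i ≤ j
  cancel-≤ fi≤fj = ≮⇒≥ λ j<i → <⇒≱ (mono-< j<i) fi≤fj

  cancel-< : ∀ {i j} → f i < f j → i < j
  cancel-< fi<fj = ≰⇒> λ j≤i → <⇒≱ fi<fj (mono-≤ j≤i)

elementsBelow : NumericalSemigroup → ℕ → ℕ
elementsBelow Λ zero = 0
elementsBelow Λ (suc n) with member? Λ n
... | yes _ = suc (elementsBelow Λ n)
... | no  _ = elementsBelow Λ n

elementsBelow+gapsBelow≡ : ∀ Λ n → elementsBelow Λ n + gapsBelow Λ n ≡ n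
elementsBelow+gapsBelow≡ Λ zero = refl
elementsBelow+gapsBelow≡ Λ (suc n) with member? Λ n
... | yes _ = cong suc (elementsBelow+gapsBelow≡ Λ n)
... | no  _ = trans (+-suc (elementsBelow Λ n) (gapsBelow Λ n)) (cong suc (elementsBelow+gapsBelow≡ Λ n))

rank≡elementsBelow : ∀ Λ c → rank Λ c ≡ elementsBelow Λ c
rank≡elementsBelow Λ c = begin
  c ∸ gapsBelow Λ c                                          ≡⟨ cong (_∸ gapsBelow Λ c) (sym (elementsBelow+gapsBelow≡ Λ c)) ⟩
  elementsBelow Λ c + gapsBelow Λ c ∸ gapsBelow Λ c          ≡⟨ m+n∸n≡m (elementsBelow Λ c) (gapsBelow Λ c) ⟩
  elementsBelow Λ c                                          ∎
  where open ≡-Reasoning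

member-above-conductor : ∀ Λ {c} → IsConductor Λ c → ∀ {n} → c ≤ n → member Λ n
member-above-conductor Λ ((m , refl , _) , gap≤m) {n} c≤n with member? Λ n
... | yes n∈Λ = n∈Λ
... | no  n∉Λ = contradiction (gap≤m n n∉Λ) (<⇒≱ c≤n)

module Enumeration (Λ : NumericalSemigroup) (lam : ℕ → ℕ) (enum : IsEnumeration Λ lam) where
  open StrictlyIncreasing (proj₁ enum) public

  index : ∀ {n} → member Λ n → ℕ
  index {n} n∈Λ = proj₁ (proj₁ (proj₂ enum n) n∈Λ)

  lam-index : ∀ {n} (n∈Λ : member Λ n) → lam (index n∈Λ) ≡ n
  lam-index {n} n∈Λ = proj₂ (proj₁ (proj₂ enum n) n∈Λ)

  lam∈Λ : ∀ i → member Λ (lam i)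
  lam∈Λ i = proj₂ (proj₂ enum (lam i)) (i , refl)

  <elementsBelow⇔ : ∀ n {i} → i < elementsBelow Λ n ⇔ lam i < n
  <elementsBelow⇔ zero = mk⇔ (λ ()) (λ ())
  <elementsBelow⇔ (suc n) {i} with member? Λ n
  ... | no n∉Λ = mk⇔ (λ i<e → m<n⇒m<1+n (to IH i<e))
                      (λ lam-i<1+n → from IH (≤∧≢⇒< (s≤s⁻¹ lam-i<1+n) lam-i≢n))
    where
    IH = <elementsBelow⇔ n
    lam-i≢n : lam i ≢ n
    lam-i≢n lam-i≡n = n∉Λ (subst (member Λ) lam-i≡n (lam∈Λ i))
  ... | yes n∈Λ = mk⇔ (s≤s ∘ to i≤e⇔lam-i≤n ∘ s≤s⁻¹) (s≤s ∘ from i≤e⇔lam-i≤n ∘ s≤s⁻¹)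
    where
    IH = <elementsBelow⇔ n
    t = index n∈Λ
    t≡e : t ≡ elementsBelow Λ n
    t≡e = ≤-antisym
      (≮⇒≥ λ e<t → <-irrefl refl (from IH (subst (lam _ <_) (lam-index n∈Λ) (mono-< e<t))))
      (≮⇒≥ λ t<e → <-irrefl (lam-index n∈Λ) (to IH t<e))
    i≤e⇔lam-i≤n : i ≤ elementsBelow Λ n ⇔ lam i ≤ n
    i≤e⇔lam-i≤n = subst₂ (λ e m → i ≤ e ⇔ lam i ≤ m) t≡e (lam-index n∈Λ) (mk⇔ mono-≤ cancel-≤)

  <rank⇔ : ∀ c {i} → i < rank Λ c ⇔ lam i < c
  <rank⇔ c {i} = subst (λ r → i < r ⇔ lam i < c) (sym (rank≡elementsBelow Λ c)) (<elementsBelow⇔ c)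

module SeedCriterion
  (Λ : NumericalSemigroup) (lam : ℕ → ℕ) (enum : IsEnumeration Λ lam)
  (c : ℕ) (conductor : IsConductor Λ c)
  (l : ℕ) (c≤l : c ≤ l)
  (j : ℕ) (lam-j≤l∸c : lam j ≤ l ∸ c) (l∸c<lam-1+j : l ∸ c < lam (suc j))
  where
  open Enumeration Λ lam enum

  SumOfLeftElements : Set
  SumOfLeftElements = ∃ λ a → ∃ λ b → a < rank Λ c × b < rank Λ c × l ≡ lam a + lam b

  SumOfLeftElementsAbove-j : Set
  SumOfLeftElementsAbove-j =
    ∃ λ a → ∃ λ b → j < a × a < rank Λ c × j < b × b < rank Λ c × l ≡ lam a + lam b

  sumAbove-j⇒sum : SumOfLeftElementsAbove-j → SumOfLeftElements
  sumAbove-j⇒sum (a , b , _ , a<k , _ , b<k , l≡) = a , b , a<k , b<k , l≡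

  ¬sum⇒¬sumAbove-j : ¬ SumOfLeftElements → ¬ SumOfLeftElementsAbove-j
  ¬sum⇒¬sumAbove-j ¬sum = ¬sum ∘ sumAbove-j⇒sum

  x : ℕ
  x = l ∸ lam j

  x+lam-j≡l : x + lam j ≡ l
  x+lam-j≡l = m∸n+n≡m (≤-trans lam-j≤l∸c (m∸n≤m l c))

  c≤x : c ≤ x
  c≤x = n≤m∸o⇒o≤m∸n c≤l lam-j≤l∸c

  l∸c<lam⇔j< : ∀ {a} → l ∸ c < lam a ⇔ j < a
  l∸c<lam⇔j< = mk⇔ (λ l∸c<lam-a → cancel-< (≤-<-trans lam-j≤l∸c l∸c<lam-a))
                    (λ j<a → <-≤-trans l∸c<lam-1+j (mono-≤ j<a))

  summand<c⇔j< : ∀ {a b} → l ≡ lam a + lam b → (lam b < c ⇔ j < a)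
  summand<c⇔j< {a} {b} l≡ = l∸c<lam⇔j< ⇔-∘
    subst (λ m → lam b < c ⇔ m ∸ c < lam a) (sym l≡) (n<o⇔m+n∸o<m (subst (c ≤_) l≡ c≤l))

  seed⇒¬orderedSum : IsSeed lam c j x → ∀ {a b} → a ≤ b → b < rank Λ c → l ≢ lam a + lam b
  seed⇒¬orderedSum (s , lam-s≡x , _ , no-sum) {a} {b} a≤b b<k l≡ =
    no-sum a b (to (summand<c⇔j< l≡) lam-b<c) a≤b b<s (trans x+lam-j≡l l≡)
    where
    lam-b<c : lam b < c
    lam-b<c = to (<rank⇔ c) b<k
    b<s : b < s
    b<s = cancel-< (<-≤-trans lam-b<c (subst (c ≤_) (sym lam-s≡x) c≤x))

  seed⇒¬sum : IsSeed lam c j x → ¬ SumOfLeftElements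
  seed⇒¬sum seed (a , b , a<k , b<k , l≡) with ≤-total a b
  ... | inj₁ a≤b = seed⇒¬orderedSum seed a≤b b<k l≡
  ... | inj₂ b≤a = seed⇒¬orderedSum seed b≤a a<k (trans l≡ (+-comm (lam a) (lam b)))

  ¬sumAbove-j⇒seed : ¬ SumOfLeftElementsAbove-j → IsSeed lam c j x
  ¬sumAbove-j⇒seed ¬sum = index x∈Λ , lam-index x∈Λ , c≤x , no-sum
    where
    x∈Λ : member Λ x
    x∈Λ = member-above-conductor Λ conductor c≤x
    no-sum : ∀ a b → j < a → a ≤ b → b < index x∈Λ → x + lam j ≢ lam a + lam b
    no-sum a b j<a a≤b _ x+lam-j≡ =
      ¬sum (a , b , j<a , from (<rank⇔ c) lam-a<c , <-≤-trans j<a a≤b , from (<rank⇔ c) lam-b<c , l≡)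
      where
      l≡ : l ≡ lam a + lam b
      l≡ = trans (sym x+lam-j≡l) x+lam-j≡
      lam-b<c : lam b < c
      lam-b<c = from (summand<c⇔j< l≡) j<a
      lam-a<c : lam a < c
      lam-a<c = ≤-<-trans (mono-≤ a≤b) lam-b<c

mainTheorem1 : (Λ : NumericalSemigroup) (lam : ℕ → ℕ) → IsEnumeration Λ lam →
    (∃ λ n → ¬ member Λ n) →
    (c : ℕ) → IsConductor Λ c →
    1 ≤ rank Λ c →
    (l : ℕ) → c ≤ l → l < 2 * c →
    (j : ℕ) → j < rank Λ c → lam j ≤ l ∸ c → l ∸ c < lam (suc j) →
    (IsSeed lam c j (l ∸ lam j) ⇔
       (¬ ∃ λ a → ∃ λ b → a < rank Λ c × b < rank Λ c × l ≡ lam a + lam b))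
    ×
    (IsSeed lam c j (l ∸ lam j) ⇔
       (¬ ∃ λ a → ∃ λ b → j < a × a < rank Λ c × j < b × b < rank Λ c × l ≡ lam a + lam b))
mainTheorem1 Λ lam enum _ c conductor _ l c≤l _ j _ lam-j≤l∸c l∸c<lam-1+j =
  mk⇔ seed⇒¬sum (¬sumAbove-j⇒seed ∘ ¬sum⇒¬sumAbove-j) ,
  mk⇔ (¬sum⇒¬sumAbove-j ∘ seed⇒¬sum) ¬sumAbove-j⇒seed
  where
  open SeedCriterion Λ lam enum c conductor l c≤l j lam-j≤l∸c l∸c<lam-1+j
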